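{- Let $p$ be a prime, $K$ a field of characteristic $p$, $n\geq2$ an integer, $r=n-1$, and $f\in K^\times$. Let $A=K[t]/(t^{p^n})$ with the Hopf algebra structure given by \[ \Delta(t)=t\otimes1+1\otimes t+f\sum_{\ell=1}^{p-1}\frac{1}{\ell!(p-\ell)!}t^{p^{r}\ell}\otimes t^{p^{r}(p-\ell)},\quad \varepsilon(t)=0,\quad \lambda(t)=-t, \] and let $H=\operatorname{Hom}_K(A,K)$ be its linear dual algebra, with multiplication $(\phi\psi)(h)=\operatorname{mult}(\phi\otimes\psi)\Delta(h)$. For $0\le j\le p^n-1$ let $z_j\in H$ be defined by $z_j(t^i)=\delta_{i,j}$ ($0\le i\le p^n-1$). Then for $0\leq s\leq r$ and $1\leq m\leq p-1$, $z_{p^{s}}^{m}=m!\,z_{mp^{s}}$ in $H$.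
   Context: $\delta_{i,j}$ is the Kronecker delta. The coefficients $1/(\ell!(p-\ell)!)$, $1\le\ell\le p-1$, are interpreted in $\mathbb{F}_p\subseteq K$. The unit of $H$ is $\varepsilon=z_0$. -}

module Defs where

open import Level using (_⊔_)
open import Algebra.Bundles using (CommutativeRing)
open import Data.Nat using (ℕ; zero; suc; _≡ᵇ_; _^_; _∸_; _<_; _≤_)
  renaming (_+_ to _+ℕ_; _*_ to _*ℕ_)
open import Data.Bool using (if_then_else_; _∧_)
open import Data.Product using (∃)
open import Relation.Nullary using (¬_)

module _ {c ℓ} (R : CommutativeRing c ℓ) where
  open CommutativeRing R
  open import Algebra.Definitions.RawMonoid +-rawMonoid using (_×_)

  record IsField : Set (c ⊔ ℓ) where
    field
      1≉0 : ¬ (1# ≈ 0#)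
      inv : ∀ x → ¬ (x ≈ 0#) → ∃ λ y → x * y ≈ 1#

  HasChar : ℕ → Set ℓ
  HasChar p = p × 1# ≈ 0#

-- The dual algebra H = Hom_K(A,K) of A = K[t]/(t^(p^n)) with the coproduct of the paper.
-- Parameters: the ring K, the prime p, n, the unit f, and coef ℓ = 1/(ℓ!(p-ℓ)!) in K.
module HopfDual {c ℓ} (R : CommutativeRing c ℓ) (p n : ℕ) (f : CommutativeRing.Carrier R)
                (coef : ℕ → CommutativeRing.Carrier R) where
  open CommutativeRing R
  open import Algebra.Definitions.RawMonoid +-rawMonoid using (_×_)

  N : ℕ
  N = p ^ n

  r : ℕ
  r = n ∸ 1

  Σ< : ℕ → (ℕ → Carrier) → Carrier
  Σ< zero    g = 0#
  Σ< (suc m) g = Σ< m g + g m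

  -- Elements of K[x,y] (x = t⊗1, y = 1⊗t) as coefficient functions:
  -- u a b is the coefficient of x^a y^b.  A ⊗ A = K[x,y]/(x^N, y^N); since
  -- coefficients of x^a y^b with a,b < N of a product depend only on such
  -- coefficients of the factors, computing in K[x,y] and reading off the
  -- coefficients with a,b < N gives exactly the product in A ⊗ A.
  Tensor : Set c
  Tensor = ℕ → ℕ → Carrier

  mono : ℕ → ℕ → Carrier → Tensor
  mono a b k i j = if (i ≡ᵇ a) ∧ (j ≡ᵇ b) then k else 0#

  _⊕_ : Tensor → Tensor → Tensor
  (u ⊕ v) i j = u i j + v i j

  _⊗*_ : Tensor → Tensor → Tensor
  (u ⊗* v) a b = Σ< (suc a) λ a₁ → Σ< (suc b) λ b₁ → u a₁ b₁ * v (a ∸ a₁) (b ∸ b₁)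

  ΣT : ℕ → (ℕ → Tensor) → Tensor
  ΣT zero    g = mono 0 0 0#
  ΣT (suc m) g = ΣT m g ⊕ g m

  Δt : Tensor
  Δt = mono 1 0 1# ⊕ (mono 0 1 1# ⊕
       ΣT p (λ l → if l ≡ᵇ 0 then mono 0 0 0#
                   else mono ((p ^ r) *ℕ l) ((p ^ r) *ℕ (p ∸ l)) (f * coef l)))

  Δpow : ℕ → Tensor
  Δpow zero    = mono 0 0 1#
  Δpow (suc i) = Δt ⊗* Δpow i

  -- Elements of H: φ i = φ(t^i), meaningful for i < N.
  H : Set c
  H = ℕ → Carrier

  _≈H_ : H → H → Set ℓ
  φ ≈H ψ = ∀ i → i < N → φ i ≈ ψ i

  _·H_ : H → H → H
  (φ ·H ψ) i = Σ< N λ a → Σ< N λ b → Δpow i a b * (φ a * ψ b)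

  z : ℕ → H
  z j i = if i ≡ᵇ j then 1# else 0#

  _•H_ : ℕ → H → H
  (k •H φ) i = k × φ i

  -- powers, with φ^0 = ε = z_0
  _^H_ : H → ℕ → H
  φ ^H zero  = z 0
  φ ^H suc m = φ ·H (φ ^H m)

{-# OPTIONS --safe #-}
-- The f-term of Δ(t) is homogeneous of total degree p^r · p = N, so in total degree
-- below N the coefficients of Δ(t^i) are those of (x + y)^i: C(i, a) at x^a y^b with
-- a + b = i, and 0 elsewhere.  Hence z_q · (m! z_{mq}) = m! C((m+1)q, q) z_{(m+1)q},
-- and C((m+1)q, q) = m + 1 in characteristic p for q = p^s.  The latter is a
-- Lucas-type identity: C(p, k) = 0 for 0 < k < p, i.e. (1 + x)^p = 1 + x^p, and this
-- property passes from p and q to pq because C(jq, iq) = C(j, i) whenever it holds for q.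
module Submission where

open import Defs
open import Algebra.Bundles using (Semiring; CommutativeRing)
open import Data.Bool using (true; false; if_then_else_; _∧_; T)
open import Data.Bool.Properties using (T-∧)
open import Data.Fin using (toℕ) renaming (zero to fzero; suc to fsuc)
open import Data.Fin.Properties using (toℕ<n)
open import Data.Nat using (ℕ; zero; suc; _+_; _*_; _∸_; _^_; _!; _≤_; _<_; _≡ᵇ_; z≤n; s≤s; z<s; s<s; >-nonZero)
open import Data.Nat.Combinatorics using (_C_; nCk+nC[k+1]≡[n+1]C[k+1]; nCk≡n!/k![n-k]!; k![n∸k]!∣n!)
open import Data.Nat.DivMod using (m/n*n≡m; _divMod_; result)
open import Data.Nat.Primality using (Prime)
open import Data.Nat.Properties using (_!*_!≢0)
import Data.Nat.Properties as ℕₚ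
open import Data.Product using (_,_)
open import Function using (_∘_)
open import Function.Bundles using (Equivalence)
open import Relation.Nullary using (¬_; yes; no; contradiction)
open import Relation.Binary.PropositionalEquality as ≡ using (_≡_; _≢_)

m*l+m*[n∸l]≡n*m : ∀ m {l n} → l ≤ n → m * l + m * (n ∸ l) ≡ n * m
m*l+m*[n∸l]≡n*m m {l} {n} l≤n = begin
  m * l + m * (n ∸ l)  ≡⟨ ℕₚ.*-distribˡ-+ m l (n ∸ l) ⟨
  m * (l + (n ∸ l))    ≡⟨ ≡.cong (m *_) (ℕₚ.m+[n∸m]≡n l≤n) ⟩
  m * n                ≡⟨ ℕₚ.*-comm m n ⟩
  n * m                ∎
  where open ≡.≡-Reasoning

k![n∸k]!*nCk≡n! : ∀ {n k} → k ≤ n → k ! * (n ∸ k) ! * (n C k) ≡ n !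
k![n∸k]!*nCk≡n! {n} {k} k≤n = ≡.trans (ℕₚ.*-comm (k ! * (n ∸ k) !) (n C k))
  (≡.trans (≡.cong (_* (k ! * (n ∸ k) !)) (nCk≡n!/k![n-k]! k≤n)) (m/n*n≡m (k![n∸k]!∣n! k≤n)))
  where instance _ = k !* (n ∸ k) !≢0

module BinomialProperties {a ℓ} (S : Semiring a ℓ) where
  open Semiring S renaming (_+_ to _+ᴿ_; _*_ to _*ᴿ_; zero to *-zero)
  open import Algebra.Properties.Semiring.Mult S using (_×_; ×-homo-+; ×1-homo-*; ×-congˡ)
  open import Algebra.Properties.CommutativeSemigroup +-commutativeSemigroup using () renaming (interchange to +-interchange)
  open import Relation.Binary.Reasoning.Setoid setoid

  binomial : ℕ → ℕ → Carrier
  binomial zero    zero    = 1#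
  binomial zero    (suc k) = 0#
  binomial (suc n) zero    = 1#
  binomial (suc n) (suc k) = binomial n k +ᴿ binomial n (suc k)

  binomial-0ʳ : ∀ n → binomial n 0 ≈ 1#
  binomial-0ʳ zero    = refl
  binomial-0ʳ (suc n) = refl

  binomial-> : ∀ {n k} → n < k → binomial n k ≈ 0#
  binomial-> {zero}  z<s       = refl
  binomial-> {suc n} (s<s n<k) =
    trans (+-cong (binomial-> n<k) (binomial-> (ℕₚ.m<n⇒m<1+n n<k))) (+-identityʳ 0#)

  binomial-diag : ∀ n → binomial n n ≈ 1#
  binomial-diag zero    = refl
  binomial-diag (suc n) = trans (+-cong (binomial-diag n) (binomial-> (ℕₚ.n<1+n n))) (+-identityʳ 1#)

  binomial-1ʳ : ∀ n → binomial n 1 ≈ n × 1#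
  binomial-1ʳ zero    = refl
  binomial-1ʳ (suc n) = +-cong (binomial-0ʳ n) (binomial-1ʳ n)

  binomial≈C : ∀ n k → binomial n k ≈ (n C k) × 1#
  binomial≈C zero    zero    = sym (+-identityʳ 1#)
  binomial≈C zero    (suc k) = refl
  binomial≈C (suc n) zero    = sym (+-identityʳ 1#)
  binomial≈C (suc n) (suc k) = begin
    binomial n k +ᴿ binomial n (suc k)  ≈⟨ +-cong (binomial≈C n k) (binomial≈C n (suc k)) ⟩
    (n C k) × 1# +ᴿ (n C suc k) × 1#    ≈⟨ ×-homo-+ 1# (n C k) (n C suc k) ⟨
    (n C k + n C suc k) × 1#            ≈⟨ ×-congˡ (nCk+nC[k+1]≡[n+1]C[k+1] n k) ⟩
    (suc n C suc k) × 1#                ∎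

  InnerBinomialsVanish : ℕ → Set ℓ
  InnerBinomialsVanish q = ∀ k → 0 < k → k < q → binomial q k ≈ 0#

  -- Over a ring of characteristic p, p! = 0, while C(p,k) k! (p-k)! = p!.
  innerBinomialsVanish-char : ∀ p (u : ℕ → Carrier) → p × 1# ≈ 0# →
    (∀ l → 1 ≤ l → l < p → u l *ᴿ ((l ! * (p ∸ l) !) × 1#) ≈ 1#) →
    InnerBinomialsVanish p
  innerBinomialsVanish-char p@(suc p′) u char inverse k 0<k k<p = begin
    binomial p k                ≈⟨ *-identityˡ _ ⟨
    1# *ᴿ binomial p k          ≈⟨ *-congʳ (inverse k 0<k k<p) ⟨
    (u k *ᴿ X) *ᴿ binomial p k  ≈⟨ *-assoc _ _ _ ⟩
    u k *ᴿ (X *ᴿ binomial p k)  ≈⟨ *-congˡ X*binomial≈0 ⟩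
    u k *ᴿ 0#                   ≈⟨ zeroʳ _ ⟩
    0#                          ∎
    where
    X : Carrier
    X = (k ! * (p ∸ k) !) × 1#
    X*binomial≈0 : X *ᴿ binomial p k ≈ 0#
    X*binomial≈0 = begin
      X *ᴿ binomial p k                   ≈⟨ *-congˡ (binomial≈C p k) ⟩
      X *ᴿ ((p C k) × 1#)                 ≈⟨ ×1-homo-* (k ! * (p ∸ k) !) (p C k) ⟨
      (k ! * (p ∸ k) ! * (p C k)) × 1#    ≈⟨ ×-congˡ (k![n∸k]!*nCk≡n! (ℕₚ.<⇒≤ k<p)) ⟩
      (p * p′ !) × 1#                     ≈⟨ ×1-homo-* p (p′ !) ⟩
      (p × 1#) *ᴿ ((p′ !) × 1#)           ≈⟨ *-congʳ char ⟩
      0# *ᴿ ((p′ !) × 1#)                 ≈⟨ zeroˡ _ ⟩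
      0#                                  ∎

  -- (1 + x)^(j q) = (1 + x^q)^j.
  module ScaledBinomials (q′ : ℕ) (vanish : InnerBinomialsVanish (suc q′)) where
    q : ℕ
    q = suc q′

    binomial-+q-< : ∀ n k → k < q → binomial (n + q) k ≈ binomial n k
    binomial-+q-< zero    zero    _   = binomial-0ʳ q
    binomial-+q-< zero    (suc k) k<q = vanish (suc k) z<s k<q
    binomial-+q-< (suc n) zero    _   = refl
    binomial-+q-< (suc n) (suc k) k<q =
      +-cong (binomial-+q-< n k (ℕₚ.<-trans (ℕₚ.n<1+n k) k<q)) (binomial-+q-< n (suc k) k<q)

    binomial-+q-+q : ∀ n j → binomial (n + q) (j + q) ≈ binomial n (j + q) +ᴿ binomial n j
    binomial-+q-+q zero    zero    = trans (binomial-diag q) (sym (+-identityˡ 1#))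
    binomial-+q-+q zero    (suc j) =
      trans (binomial-> (s≤s (ℕₚ.m≤n+m q j))) (sym (+-identityʳ 0#))
    binomial-+q-+q (suc n) zero    = begin
      binomial (n + q) q′ +ᴿ binomial (n + q) q        ≈⟨ +-cong (binomial-+q-< n q′ (ℕₚ.n<1+n q′))
                                                                 (binomial-+q-+q n zero) ⟩
      binomial n q′ +ᴿ (binomial n q +ᴿ binomial n 0)  ≈⟨ +-assoc _ _ _ ⟨
      binomial (suc n) q +ᴿ binomial n 0               ≈⟨ +-congˡ (binomial-0ʳ n) ⟩
      binomial (suc n) q +ᴿ 1#                         ∎
    binomial-+q-+q (suc n) (suc j) = begin
      binomial (n + q) (j + q) +ᴿ binomial (n + q) (suc j + q)
        ≈⟨ +-cong (binomial-+q-+q n j) (binomial-+q-+q n (suc j)) ⟩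
      (binomial n (j + q) +ᴿ binomial n j) +ᴿ (binomial n (suc j + q) +ᴿ binomial n (suc j))
        ≈⟨ +-interchange _ _ _ _ ⟩
      binomial (suc n) (suc j + q) +ᴿ binomial (suc n) (suc j) ∎

    binomial-*q : ∀ j i → binomial (j * q) (i * q) ≈ binomial j i
    binomial-*q zero    zero    = refl
    binomial-*q zero    (suc i) = binomial-> (ℕₚ.<-≤-trans z<s (ℕₚ.m≤m+n q (i * q)))
    binomial-*q (suc j) zero    = binomial-0ʳ (suc j * q)
    binomial-*q (suc j) (suc i) = begin
      binomial (q + j * q) (q + i * q)
        ≡⟨ ≡.cong₂ binomial (ℕₚ.+-comm q (j * q)) (ℕₚ.+-comm q (i * q)) ⟩
      binomial (j * q + q) (i * q + q)
        ≈⟨ binomial-+q-+q (j * q) (i * q) ⟩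
      binomial (j * q) (i * q + q) +ᴿ binomial (j * q) (i * q)
        ≡⟨ ≡.cong (λ k → binomial (j * q) k +ᴿ binomial (j * q) (i * q)) (ℕₚ.+-comm (i * q) q) ⟩
      binomial (j * q) (suc i * q) +ᴿ binomial (j * q) (i * q)
        ≈⟨ +-cong (binomial-*q j (suc i)) (binomial-*q j i) ⟩
      binomial j (suc i) +ᴿ binomial j i
        ≈⟨ +-comm _ _ ⟩
      binomial (suc j) (suc i) ∎

    binomial-*q-+ : ∀ j i r → 0 < r → r < q → binomial (j * q) (i * q + r) ≈ 0#
    binomial-*q-+ zero    i       r 0<r _   = binomial-> (ℕₚ.<-≤-trans 0<r (ℕₚ.m≤n+m r (i * q)))
    binomial-*q-+ (suc j) zero    r 0<r r<q = begin
      binomial (q + j * q) r    ≡⟨ ≡.cong (λ n → binomial n r) (ℕₚ.+-comm q (j * q)) ⟩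
      binomial (j * q + q) r    ≈⟨ binomial-+q-< (j * q) r r<q ⟩
      binomial (j * q) r        ≈⟨ binomial-*q-+ j zero r 0<r r<q ⟩
      0#                        ∎
    binomial-*q-+ (suc j) (suc i) r 0<r r<q = begin
      binomial (q + j * q) ((q + i * q) + r)
        ≡⟨ ≡.cong₂ binomial (ℕₚ.+-comm q (j * q)) shift ⟩
      binomial (j * q + q) ((i * q + r) + q)
        ≈⟨ binomial-+q-+q (j * q) (i * q + r) ⟩
      binomial (j * q) ((i * q + r) + q) +ᴿ binomial (j * q) (i * q + r)
        ≡⟨ ≡.cong (λ k → binomial (j * q) k +ᴿ binomial (j * q) (i * q + r)) shift ⟨
      binomial (j * q) (suc i * q + r) +ᴿ binomial (j * q) (i * q + r)
        ≈⟨ +-cong (binomial-*q-+ j (suc i) r 0<r r<q) (binomial-*q-+ j i r 0<r r<q) ⟩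
      0# +ᴿ 0#
        ≈⟨ +-identityʳ 0# ⟩
      0# ∎
      where
      shift : (q + i * q) + r ≡ (i * q + r) + q
      shift = ≡.trans (ℕₚ.+-assoc q (i * q) r) (ℕₚ.+-comm q (i * q + r))

  innerBinomialsVanish-* : ∀ {p q} → 0 < q → InnerBinomialsVanish p → InnerBinomialsVanish q →
                           InnerBinomialsVanish (p * q)
  innerBinomialsVanish-* {p} {q@(suc q′)} _ vanish-p vanish-q k 0<k k<pq with k divMod q
  ... | result zero     fzero      ≡.refl = contradiction 0<k (λ ())
  ... | result (suc i′) fzero      ≡.refl = begin
    binomial (p * q) (suc i′ * q)  ≈⟨ binomial-*q p (suc i′) ⟩
    binomial p (suc i′)            ≈⟨ vanish-p (suc i′) z<s (ℕₚ.*-cancelʳ-< q (suc i′) p k<pq) ⟩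
    0#                             ∎
    where open ScaledBinomials q′ vanish-q using (binomial-*q)
  ... | result i        (fsuc r)   ≡.refl = begin
    binomial (p * q) (suc (toℕ r) + i * q)  ≡⟨ ≡.cong (binomial (p * q)) (ℕₚ.+-comm (suc (toℕ r)) (i * q)) ⟩
    binomial (p * q) (i * q + suc (toℕ r))  ≈⟨ binomial-*q-+ p i (suc (toℕ r)) z<s (toℕ<n (fsuc r)) ⟩
    0#                                      ∎
    where open ScaledBinomials q′ vanish-q using (binomial-*q-+)

  innerBinomialsVanish-^ : ∀ {p} → 0 < p → InnerBinomialsVanish p → ∀ s → InnerBinomialsVanish (p ^ s)
  innerBinomialsVanish-^ _       _       zero    (suc k) _ (s<s ())
  innerBinomialsVanish-^ {p@(suc _)} 0<p vanish (suc s) =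
    innerBinomialsVanish-* (ℕₚ.m^n>0 p s) vanish (innerBinomialsVanish-^ 0<p vanish s)

  binomial-*q-q : ∀ {q} → 0 < q → InnerBinomialsVanish q → ∀ m → binomial (m * q) q ≈ m × 1#
  binomial-*q-q {q@(suc q′)} _ vanish m = begin
    binomial (m * q) q        ≡⟨ ≡.cong (binomial (m * q)) (≡.sym (ℕₚ.+-identityʳ q)) ⟩
    binomial (m * q) (1 * q)  ≈⟨ binomial-*q m 1 ⟩
    binomial m 1              ≈⟨ binomial-1ʳ m ⟩
    m × 1#                    ∎
    where open ScaledBinomials q′ vanish using (binomial-*q)

module HopfDualProperties {c ℓ} (R : CommutativeRing c ℓ) (p r : ℕ) (f : CommutativeRing.Carrier R)
                          (coef : ℕ → CommutativeRing.Carrier R) where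
  open CommutativeRing R renaming (_+_ to _+ᴿ_; _*_ to _*ᴿ_; zero to *-zero)
  open HopfDual R p (suc r) f coef hiding (r)
  open BinomialProperties semiring
  open import Algebra.Properties.Semiring.Mult semiring using (_×_; ×-congʳ; ×1-homo-*)
  open import Relation.Binary.Reasoning.Setoid setoid

  Σ<-cong : ∀ m {g h : ℕ → Carrier} → (∀ k → k < m → g k ≈ h k) → Σ< m g ≈ Σ< m h
  Σ<-cong zero    _  = refl
  Σ<-cong (suc m) eq = +-cong (Σ<-cong m (λ k k<m → eq k (ℕₚ.m<n⇒m<1+n k<m))) (eq m (ℕₚ.n<1+n m))

  Σ<-zero : ∀ m {g : ℕ → Carrier} → (∀ k → k < m → g k ≈ 0#) → Σ< m g ≈ 0#
  Σ<-zero zero    _  = refl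
  Σ<-zero (suc m) eq =
    trans (+-cong (Σ<-zero m (λ k k<m → eq k (ℕₚ.m<n⇒m<1+n k<m))) (eq m (ℕₚ.n<1+n m))) (+-identityʳ 0#)

  Σ<-single : ∀ m {g : ℕ → Carrier} k → k < m → (∀ j → j < m → j ≢ k → g j ≈ 0#) → Σ< m g ≈ g k
  Σ<-single (suc m) k k<1+m eq with k ℕₚ.≟ m
  ... | yes ≡.refl = trans (+-congʳ (Σ<-zero m (λ j j<m → eq j (ℕₚ.m<n⇒m<1+n j<m) (ℕₚ.<⇒≢ j<m))))
                           (+-identityˡ _)
  ... | no k≢m     = trans (+-cong (Σ<-single m k (ℕₚ.≤∧≢⇒< (ℕₚ.≤-pred k<1+m) k≢m)
                                                  (λ j j<m → eq j (ℕₚ.m<n⇒m<1+n j<m)))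
                                   (eq m (ℕₚ.n<1+n m) (λ m≡k → k≢m (≡.sym m≡k))))
                           (+-identityʳ _)

  if-false : ∀ b {x y : Carrier} → ¬ T b → (if b then x else y) ≈ y
  if-false true  ¬b = contradiction _ ¬b
  if-false false _  = refl

  if-true : ∀ b {x y : Carrier} → T b → (if b then x else y) ≈ x
  if-true true _ = refl

  mono-0# : ∀ a b i j → mono a b 0# i j ≈ 0#
  mono-0# a b i j with (i ≡ᵇ a) ∧ (j ≡ᵇ b)
  ... | true  = refl
  ... | false = refl

  mono-off : ∀ a b k i j → (i ≡ a → j ≢ b) → mono a b k i j ≈ 0#
  mono-off a b k i j off = if-false ((i ≡ᵇ a) ∧ (j ≡ᵇ b)) λ t →
    let (i≡a , j≡b) = Equivalence.to T-∧ t in off (ℕₚ.≡ᵇ⇒≡ i a i≡a) (ℕₚ.≡ᵇ⇒≡ j b j≡b)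

  fTerm : ℕ → Tensor
  fTerm l = if l ≡ᵇ 0 then mono 0 0 0# else mono (p ^ r * l) (p ^ r * (p ∸ l)) (f *ᴿ coef l)

  fTerm-low : ∀ l → l < p → ∀ a b → a + b < N → fTerm l a b ≈ 0#
  fTerm-low zero    _   a b _    = mono-0# 0 0 a b
  fTerm-low (suc l) l<p a b a+b<N = mono-off _ _ _ a b λ { ≡.refl ≡.refl →
    ℕₚ.<⇒≢ a+b<N (m*l+m*[n∸l]≡n*m (p ^ r) (ℕₚ.<⇒≤ l<p)) }

  ΣT-fTerm-low : ∀ m → m ≤ p → ∀ a b → a + b < N → ΣT m fTerm a b ≈ 0#
  ΣT-fTerm-low zero    _   a b _     = mono-0# 0 0 a b
  ΣT-fTerm-low (suc m) m<p a b a+b<N =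
    trans (+-cong (ΣT-fTerm-low m (ℕₚ.<⇒≤ m<p) a b a+b<N) (fTerm-low m m<p a b a+b<N)) (+-identityʳ 0#)

  x+y : Tensor
  x+y 1 0 = 1#
  x+y 0 1 = 1#
  x+y _ _ = 0#

  Δt-low : ∀ a b → a + b < N → Δt a b ≈ x+y a b
  Δt-low a b a+b<N = trans (+-congˡ (+-congˡ (ΣT-fTerm-low p ℕₚ.≤-refl a b a+b<N))) (linear a b)
    where
    linear : ∀ a b → mono 1 0 1# a b +ᴿ (mono 0 1 1# a b +ᴿ 0#) ≈ x+y a b
    linear 0             0             = trans (+-identityˡ _) (+-identityʳ 0#)
    linear 0             1             = trans (+-identityˡ _) (+-identityʳ 1#)
    linear 0             (suc (suc b)) = trans (+-identityˡ _) (+-identityʳ 0#)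
    linear 1             0             = trans (+-congˡ (+-identityʳ 0#)) (+-identityʳ 1#)
    linear 1             (suc b)       = trans (+-identityˡ _) (+-identityʳ 0#)
    linear (suc (suc a)) b             = trans (+-identityˡ _) (+-identityʳ 0#)

  mul-x+y : Tensor → Tensor
  mul-x+y v zero    zero    = 0#
  mul-x+y v (suc a) zero    = v a 0
  mul-x+y v zero    (suc b) = v 0 b
  mul-x+y v (suc a) (suc b) = v (suc a) b +ᴿ v a (suc b)

  Σ<-first-two : ∀ m {g : ℕ → Carrier} → (∀ k → 2 ≤ k → g k ≈ 0#) → Σ< (suc (suc m)) g ≈ g 0 +ᴿ g 1
  Σ<-first-two zero    _     = +-congʳ (+-identityˡ _)
  Σ<-first-two (suc m) zeros = trans (+-cong (Σ<-first-two m zeros) (zeros (suc (suc m)) (s≤s (s≤s z≤n))))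
                                     (+-identityʳ _)

  module _ (h : ℕ → Carrier) where
    x+y-row₀ : ∀ b → Σ< (suc (suc b)) (λ b₁ → x+y 0 b₁ *ᴿ h b₁) ≈ h 1
    x+y-row₀ b = trans (Σ<-single (suc (suc b)) 1 (s≤s (s≤s z≤n)) off) (*-identityˡ _)
      where
      off : ∀ j → j < suc (suc b) → j ≢ 1 → x+y 0 j *ᴿ h j ≈ 0#
      off zero          _ _   = zeroˡ _
      off 1             _ j≢1 = contradiction ≡.refl j≢1
      off (suc (suc j)) _ _   = zeroˡ _

    x+y-row₁ : ∀ b → Σ< (suc b) (λ b₁ → x+y 1 b₁ *ᴿ h b₁) ≈ h 0
    x+y-row₁ b = trans (Σ<-single (suc b) 0 z<s off) (*-identityˡ _)
      where
      off : ∀ j → j < suc b → j ≢ 0 → x+y 1 j *ᴿ h j ≈ 0#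
      off zero    _ j≢0 = contradiction ≡.refl j≢0
      off (suc j) _ _   = zeroˡ _

  x+y-row≥2 : ∀ a₁ → 2 ≤ a₁ → ∀ b (h : ℕ → Carrier) → Σ< b (λ b₁ → x+y a₁ b₁ *ᴿ h b₁) ≈ 0#
  x+y-row≥2 (suc zero)    (s≤s ())
  x+y-row≥2 (suc (suc _)) _        b h = Σ<-zero b (λ _ _ → zeroˡ _)

  x+y-⊗* : ∀ v a b → (x+y ⊗* v) a b ≈ mul-x+y v a b
  x+y-⊗* v zero    zero    = trans (+-identityˡ _) (trans (+-identityˡ _) (zeroˡ _))
  x+y-⊗* v zero    (suc b) = trans (+-identityˡ _) (x+y-row₀ (λ b₁ → v 0 (suc b ∸ b₁)) b)
  x+y-⊗* v (suc a) zero    =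
    trans (Σ<-first-two a (λ a₁ 2≤a₁ → x+y-row≥2 a₁ 2≤a₁ 1 (λ b₁ → v (suc a ∸ a₁) (0 ∸ b₁))))
          (trans (+-cong (trans (+-identityˡ _) (zeroˡ _)) (x+y-row₁ (λ _ → v a 0) 0)) (+-identityˡ _))
  x+y-⊗* v (suc a) (suc b) =
    trans (Σ<-first-two a (λ a₁ 2≤a₁ → x+y-row≥2 a₁ 2≤a₁ (suc (suc b)) _))
          (+-cong (x+y-row₀ (λ b₁ → v (suc a) (suc b ∸ b₁)) b) (x+y-row₁ (λ b₁ → v a (suc b ∸ b₁)) (suc b)))

  ⊗*-congʳ-low : ∀ {u u′} v → (∀ a b → a + b < N → u a b ≈ u′ a b) →
                 ∀ a b → a + b < N → (u ⊗* v) a b ≈ (u′ ⊗* v) a b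
  ⊗*-congʳ-low v u≈u′ a b a+b<N = Σ<-cong (suc a) λ a₁ a₁≤a → Σ<-cong (suc b) λ b₁ b₁≤b →
    *-congʳ (u≈u′ a₁ b₁ (ℕₚ.≤-<-trans (ℕₚ.+-mono-≤ (ℕₚ.≤-pred a₁≤a) (ℕₚ.≤-pred b₁≤b)) a+b<N))

  Δpow-suc-low : ∀ i a b → a + b < N → Δpow (suc i) a b ≈ mul-x+y (Δpow i) a b
  Δpow-suc-low i a b a+b<N = trans (⊗*-congʳ-low (Δpow i) Δt-low a b a+b<N) (x+y-⊗* (Δpow i) a b)

  private
    pred-< : ∀ {x} → suc x < N → x < N
    pred-< = ℕₚ.<-trans (ℕₚ.n<1+n _)

    pred₂-< : ∀ a b → suc a + suc b < N → suc a + b < N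
    pred₂-< a b = ℕₚ.≤-<-trans (ℕₚ.+-monoʳ-≤ (suc a) (ℕₚ.n≤1+n b))

  Δpow-diag : ∀ i a b → a + b < N → a + b ≡ i → Δpow i a b ≈ binomial i a
  Δpow-diag zero    zero    zero    _     _  = refl
  Δpow-diag (suc i) zero    (suc b) a+b<N eq = begin
    Δpow (suc i) 0 (suc b)  ≈⟨ Δpow-suc-low i 0 (suc b) a+b<N ⟩
    Δpow i 0 b              ≈⟨ Δpow-diag i 0 b (pred-< a+b<N) (ℕₚ.suc-injective eq) ⟩
    binomial i 0            ≈⟨ binomial-0ʳ i ⟩
    1#                      ∎
  Δpow-diag (suc i) (suc a) zero    a+b<N eq = begin
    Δpow (suc i) (suc a) 0               ≈⟨ Δpow-suc-low i (suc a) 0 a+b<N ⟩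
    Δpow i a 0                           ≈⟨ Δpow-diag i a 0 (pred-< a+b<N) (ℕₚ.suc-injective eq) ⟩
    binomial i a                         ≈⟨ +-identityʳ _ ⟨
    binomial i a +ᴿ 0#                   ≈⟨ +-congˡ (binomial-> (s≤s (ℕₚ.≤-reflexive i≡a))) ⟨
    binomial (suc i) (suc a)             ∎
    where
    i≡a : i ≡ a
    i≡a = ≡.trans (≡.sym (ℕₚ.suc-injective eq)) (ℕₚ.+-identityʳ a)
  Δpow-diag (suc i) (suc a) (suc b) a+b<N eq = begin
    Δpow (suc i) (suc a) (suc b)         ≈⟨ Δpow-suc-low i (suc a) (suc b) a+b<N ⟩
    Δpow i (suc a) b +ᴿ Δpow i a (suc b) ≈⟨ +-cong (Δpow-diag i (suc a) b (pred₂-< a b a+b<N)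
                                                              (≡.trans (≡.sym (ℕₚ.+-suc a b)) eq′))
                                                   (Δpow-diag i a (suc b) (pred-< a+b<N) eq′) ⟩
    binomial i (suc a) +ᴿ binomial i a   ≈⟨ +-comm _ _ ⟩
    binomial (suc i) (suc a)             ∎
    where
    eq′ : a + suc b ≡ i
    eq′ = ℕₚ.suc-injective eq

  Δpow-off-diag : ∀ i a b → a + b < N → a + b ≢ i → Δpow i a b ≈ 0#
  Δpow-off-diag zero    zero    zero    _     ne = contradiction ≡.refl ne
  Δpow-off-diag zero    (suc a) b       _     _  = refl
  Δpow-off-diag zero    zero    (suc b) _     _  = refl
  Δpow-off-diag (suc i) zero    zero    a+b<N _  = Δpow-suc-low i 0 0 a+b<N
  Δpow-off-diag (suc i) (suc a) zero    a+b<N ne = trans (Δpow-suc-low i (suc a) 0 a+b<N)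
    (Δpow-off-diag i a 0 (pred-< a+b<N) (ne ∘ ≡.cong suc))
  Δpow-off-diag (suc i) zero    (suc b) a+b<N ne = trans (Δpow-suc-low i 0 (suc b) a+b<N)
    (Δpow-off-diag i 0 b (pred-< a+b<N) (ne ∘ ≡.cong suc))
  Δpow-off-diag (suc i) (suc a) (suc b) a+b<N ne = trans (Δpow-suc-low i (suc a) (suc b) a+b<N)
    (trans (+-cong (Δpow-off-diag i (suc a) b (pred₂-< a b a+b<N) (ne ∘ ≡.cong suc ∘ ≡.trans (ℕₚ.+-suc a b)))
                   (Δpow-off-diag i a (suc b) (pred-< a+b<N) (ne ∘ ≡.cong suc)))
           (+-identityʳ 0#))

  ×-zeroʳ : ∀ k → k × 0# ≈ 0#
  ×-zeroʳ zero    = refl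
  ×-zeroʳ (suc k) = trans (+-congˡ (×-zeroʳ k)) (+-identityʳ 0#)

  z-diag : ∀ j → z j j ≈ 1#
  z-diag j = if-true (j ≡ᵇ j) (ℕₚ.≡⇒≡ᵇ j j ≡.refl)

  z-off-diag : ∀ j i → i ≢ j → z j i ≈ 0#
  z-off-diag j i i≢j = if-false (i ≡ᵇ j) (i≢j ∘ ℕₚ.≡ᵇ⇒≡ i j)

  ·H-congˡ : ∀ φ {ψ ψ′} → ψ ≈H ψ′ → ∀ i → (φ ·H ψ) i ≈ (φ ·H ψ′) i
  ·H-congˡ φ ψ≈ψ′ i = Σ<-cong N λ a _ → Σ<-cong N λ b b<N → *-congˡ (*-congˡ (ψ≈ψ′ b b<N))

  z-·H-•H-z : ∀ {j k} → j < N → k < N → ∀ c i → (z j ·H (c •H z k)) i ≈ Δpow i j k *ᴿ (c × 1#)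
  z-·H-•H-z {j} {k} j<N k<N c i = begin
    (z j ·H (c •H z k)) i
      ≈⟨ Σ<-single N j j<N (λ a _ a≢j → Σ<-zero N λ b _ →
           trans (*-congˡ (trans (*-congʳ (z-off-diag j a a≢j)) (zeroˡ _))) (zeroʳ _)) ⟩
    Σ< N (λ b → Δpow i j b *ᴿ (z j j *ᴿ (c × z k b)))
      ≈⟨ Σ<-single N k k<N (λ b _ b≢k →
           trans (*-congˡ (trans (*-congˡ (trans (×-congʳ c (z-off-diag k b b≢k)) (×-zeroʳ c))) (zeroʳ _)))
                 (zeroʳ _)) ⟩
    Δpow i j k *ᴿ (z j j *ᴿ (c × z k k))
      ≈⟨ *-congˡ (trans (*-cong (z-diag j) (×-congʳ c (z-diag k))) (*-identityˡ _)) ⟩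
    Δpow i j k *ᴿ (c × 1#)
      ∎

  module _ {q} (0<q : 0 < q) (vanish : InnerBinomialsVanish q) where
    Δpow-q-mq : ∀ m → suc m * q < N → ∀ i → Δpow i q (m * q) *ᴿ ((m !) × 1#) ≈ (suc m !) × z (suc m * q) i
    Δpow-q-mq m [m+1]q<N i with i ℕₚ.≟ suc m * q
    ... | yes ≡.refl = begin
      Δpow (suc m * q) q (m * q) *ᴿ ((m !) × 1#)  ≈⟨ *-congʳ (Δpow-diag _ q (m * q) [m+1]q<N ≡.refl) ⟩
      binomial (suc m * q) q *ᴿ ((m !) × 1#)      ≈⟨ *-congʳ (binomial-*q-q 0<q vanish (suc m)) ⟩
      (suc m × 1#) *ᴿ ((m !) × 1#)                ≈⟨ ×1-homo-* (suc m) (m !) ⟨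
      (suc m !) × 1#                              ≈⟨ ×-congʳ (suc m !) (z-diag (suc m * q)) ⟨
      (suc m !) × z (suc m * q) (suc m * q)       ∎
    ... | no i≢[m+1]q = begin
      Δpow i q (m * q) *ᴿ ((m !) × 1#)  ≈⟨ *-congʳ (Δpow-off-diag i q (m * q) [m+1]q<N (i≢[m+1]q ∘ ≡.sym)) ⟩
      0# *ᴿ ((m !) × 1#)                ≈⟨ zeroˡ _ ⟩
      0#                                ≈⟨ ×-zeroʳ (suc m !) ⟨
      (suc m !) × 0#                    ≈⟨ ×-congʳ (suc m !) (z-off-diag (suc m * q) i i≢[m+1]q) ⟨
      (suc m !) × z (suc m * q) i       ∎

    z-^H : ∀ m → m * q < N → (z q ^H m) ≈H ((m !) •H z (m * q))
    z-^H zero    _        i _ = sym (+-identityʳ _)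
    z-^H (suc m) [m+1]q<N i _ = begin
      (z q ·H (z q ^H m)) i             ≈⟨ ·H-congˡ (z q) (z-^H m mq<N) i ⟩
      (z q ·H ((m !) •H z (m * q))) i   ≈⟨ z-·H-•H-z q<N mq<N (m !) i ⟩
      Δpow i q (m * q) *ᴿ ((m !) × 1#)  ≈⟨ Δpow-q-mq m [m+1]q<N i ⟩
      (suc m !) × z (suc m * q) i       ∎
      where
      q<N : q < N
      q<N = ℕₚ.≤-<-trans (ℕₚ.m≤m+n q (m * q)) [m+1]q<N
      mq<N : m * q < N
      mq<N = ℕₚ.≤-<-trans (ℕₚ.m≤n+m (m * q) q) [m+1]q<N

open import Algebra.Definitions.RawMonoid using (_×_)

lemma5p2 : ∀ {c ℓ} (R : CommutativeRing c ℓ) → IsField R →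
    (p : ℕ) → Prime p → HasChar R p →
    (n : ℕ) → 2 ≤ n →
    (f : CommutativeRing.Carrier R) → ¬ (CommutativeRing._≈_ R f (CommutativeRing.0# R)) →
    (coef : ℕ → CommutativeRing.Carrier R) →
    (∀ l → 1 ≤ l → l < p →
      CommutativeRing._≈_ R
        (CommutativeRing._*_ R (coef l)
          (_×_ (CommutativeRing.+-rawMonoid R) ((l !) * ((p ∸ l) !)) (CommutativeRing.1# R)))
        (CommutativeRing.1# R)) →
    ∀ s m → s ≤ n ∸ 1 → 1 ≤ m → m < p →
      HopfDual._≈H_ R p n f coef
        (HopfDual._^H_ R p n f coef (HopfDual.z R p n f coef (p ^ s)) m)
        (HopfDual._•H_ R p n f coef (m !) (HopfDual.z R p n f coef (m * (p ^ s))))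
lemma5p2 R _ p _ char (suc r) _ f _ coef inverse s m s≤r _ m<p =
  HopfDualProperties.z-^H R p r f coef (ℕₚ.m^n>0 p s) vanish m (ℕₚ.<-≤-trans m*p^s<p*p^s p^[1+s]≤p^[1+r])
  where
  open BinomialProperties (CommutativeRing.semiring R)
  0<p : 0 < p
  0<p = ℕₚ.≤-<-trans z≤n m<p
  instance _ = >-nonZero 0<p
  vanish : InnerBinomialsVanish (p ^ s)
  vanish = innerBinomialsVanish-^ 0<p (innerBinomialsVanish-char p coef char inverse) s
  m*p^s<p*p^s : m * p ^ s < p * p ^ s
  m*p^s<p*p^s = ℕₚ.*-monoˡ-< (p ^ s) {{ℕₚ.m^n≢0 p s}} m<p
  p^[1+s]≤p^[1+r] : p ^ suc s ≤ p ^ suc r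
  p^[1+s]≤p^[1+r] = ℕₚ.^-monoʳ-≤ p (s≤s s≤r)
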